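{- Let $\Delta$ be a program (a finite list of $D$-formulas) and $G$ a goal ($G$-formula) of the language Prolog$_{\oplus}$. Then executing $\langle\Delta,G\rangle$, i.e. $ex(\Delta,G)$, terminates with a success if and only if $G$ follows from $!\Delta$ in intuitionistic linear logic.
   Context: Syntax of Prolog$_{\oplus}$ (first-order; $A$ ranges over atomic formulas): $G ::= A \mid G\otimes G \mid \exists x\, G$ (goals); $C ::= A \mid G\supset A \mid \forall x\, C$ (Horn clauses); $D ::= \,!C \mid D\oplus D$ (choice-disjunctive clauses). Here $\otimes$ is multiplicative conjunction, $\oplus$ additive disjunction, $!$ the exponential, $\supset$ implication. A program is a list of $D$-formulas ($::$ is cons, $nil$ the empty list); $!\Delta$ denotes the program formulas each prefixed by $!$. $\mathcal P$ denotes a set of Horn clauses. Proof procedure $pv$: $pv(\Delta,G)$ if $pv_D^\Uparrow(nil,\Delta,G)$; $pv_D^\Uparrow(\mathcal P,!C::\Delta,G)$ if $pv_D^\Uparrow(\{!C\}\cup\mathcal P,\Delta,G)$; $pv_D^\Uparrow(\mathcal P,(D_0\oplus D_1)::\Delta,G)$ if $pv_D^\Uparrow(\mathcal P,D_0::\Delta,G)$ and $pv_D^\Uparrow(\mathcal P,D_1::\Delta,G)$; $pv_D^\Uparrow(\mathcal P,nil,G)$ if $pv_G(\mathcal P,G)$; $pv_D^\Downarrow(A,\mathcal P,A)$; $pv_D^\Downarrow(G_0\supset A,\mathcal P,A)$ if $pv_G(\mathcal P,G_0)$; $pv_D^\Downarrow(\forall x D,\mathcal P,A)$ if $pv_D^\Downarrow([t/x]D,\mathcal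 P,A)$ for some term $t$; $pv_G(\mathcal P,A)$ if $D\in\mathcal P$ and $pv_D^\Downarrow(D,\mathcal P,A)$; $pv_G(\mathcal P,G_0\otimes G_1)$ if $pv_G(\mathcal P,G_0)$ and $pv_G(\mathcal P,G_1)$; $pv_G(\mathcal P,\exists x G_0)$ if $pv_G(\mathcal P,[t/x]G_0)$ for some term $t$. Execution procedure $ex$ (identical except for the treatment of $\oplus$): 1. $ex(\Delta,G)$ if $ex_D^\Uparrow(nil,\Delta,G)$. 2. $ex_D^\Uparrow(\mathcal P,!C::\Delta,G)$ if $ex_D^\Uparrow(\{!C\}\cup\mathcal P,\Delta,G)$. 3. $ex_D^\Uparrow(\mathcal P,(D_0\oplus D_1)::\Delta,G)$ if $read(i)$ and $ex_D^\Uparrow(\mathcal P,D_i::\Delta,G)$ and $pv_D^\Uparrow(\mathcal P,D_j::\Delta,G)$, where $i\in\{0,1\}$ is chosen by the user (read interactively) and $j=(i+1)\bmod 2$. 4. $ex_D^\Uparrow(\mathcal P,nil,G)$ if $ex_G(\mathcal P,G)$. 5. $ex_D^\Downarrow(A,\mathcal P,A)$ (success). 6. $ex_D^\Downarrow(G_0\supset A,\mathcal P,A)$ if $ex_G(\mathcal P,G_0)$. 7. $ex_D^\Downarrow(\forall x D,\mathcal P,A)$ if $ex_D^\Downarrow([t/x]D,\mathcal P,A)$ for some term $t$. 8. $ex_G(\mathcal P,A)$ if $D\in\mathcal P$ and $ex_D^\Downarrow(D,\mathcal P,A)$. 9. $ex_G(\mathcal P,G_0\otimes G_1)$ if $ex_G(\mathcal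 P,G_0)$ and $ex_G(\mathcal P,G_1)$. 10. $ex_G(\mathcal P,\exists x G_0)$ if $ex_G(\mathcal P,[t/x]G_0)$ for some term $t$. -}

module Defs where

-- Variables are de Bruijn indices; each quantifier binds index 0.

open import Data.Nat using (ℕ; zero; suc; _<ᵇ_; _≡ᵇ_; pred)
open import Data.Bool using (Bool; true; false; if_then_else_)
open import Data.List using (List; []; _∷_; _++_; map)
open import Data.List.Membership.Propositional using (_∈_)
open import Data.List.Relation.Binary.Permutation.Propositional using (_↭_)
open import Relation.Binary.PropositionalEquality using (_≡_)

data Term : Set where
  var : ℕ → Term
  fn  : ℕ → List Term → Term

data Atom : Set where
  patom : ℕ → List Term → Atom

mutual
  shiftT : ℕ → Term → Term
  shiftT c (var x)   = if x <ᵇ c then var x else var (suc x)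
  shiftT c (fn f ts) = fn f (shiftTs c ts)

  shiftTs : ℕ → List Term → List Term
  shiftTs c []       = []
  shiftTs c (t ∷ ts) = shiftT c t ∷ shiftTs c ts

mutual
  substT : ℕ → Term → Term → Term
  substT k t (var x)   =
    if x ≡ᵇ k then t else (if x <ᵇ k then var x else var (pred x))
  substT k t (fn f ts) = fn f (substTs k t ts)

  substTs : ℕ → Term → List Term → List Term
  substTs k t []       = []
  substTs k t (u ∷ us) = substT k t u ∷ substTs k t us

shiftA : ℕ → Atom → Atom
shiftA c (patom p ts) = patom p (shiftTs c ts)

substA : ℕ → Term → Atom → Atom
substA k t (patom p ts) = patom p (substTs k t ts)

data Goal : Set where
  atm : Atom → Goal
  _⊗_ : Goal → Goal → Goal
  ex∃ : Goal → Goal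

data Clause : Set where
  fact : Atom → Clause
  _⊃_  : Goal → Atom → Clause
  all∀ : Clause → Clause

data DForm : Set where
  !_  : Clause → DForm
  _⊕_ : DForm → DForm → DForm

substG : ℕ → Term → Goal → Goal
substG k t (atm a)   = atm (substA k t a)
substG k t (g ⊗ h)   = substG k t g ⊗ substG k t h
substG k t (ex∃ g)   = ex∃ (substG (suc k) (shiftT 0 t) g)

substC : ℕ → Term → Clause → Clause
substC k t (fact a)  = fact (substA k t a)
substC k t (g ⊃ a)   = substG k t g ⊃ substA k t a
substC k t (all∀ c)  = all∀ (substC (suc k) (shiftT 0 t) c)

_[_]G : Goal → Term → Goal
g [ t ]G = substG 0 t g

_[_]C : Clause → Term → Clause
c [ t ]C = substC 0 t c

-- The proof procedure pv.  A set 𝒫 of Horn clauses (each understood as !C)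
-- is represented by a list; {!C} ∪ 𝒫 is C ∷ 𝒫 and D ∈ 𝒫 is list membership.

Prog : Set
Prog = List Clause

mutual
  data PvD⇑ : Prog → List DForm → Goal → Set where
    pv-! : ∀ {𝒫 C Δ G} → PvD⇑ (C ∷ 𝒫) Δ G → PvD⇑ 𝒫 ((! C) ∷ Δ) G
    pv-⊕ : ∀ {𝒫 D₀ D₁ Δ G} →
           PvD⇑ 𝒫 (D₀ ∷ Δ) G → PvD⇑ 𝒫 (D₁ ∷ Δ) G → PvD⇑ 𝒫 ((D₀ ⊕ D₁) ∷ Δ) G
    pv-nil : ∀ {𝒫 G} → PvG 𝒫 G → PvD⇑ 𝒫 [] G

  data PvD⇓ : Clause → Prog → Atom → Set where
    pv-fact : ∀ {𝒫 A} → PvD⇓ (fact A) 𝒫 A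
    pv-⊃    : ∀ {𝒫 G₀ A} → PvG 𝒫 G₀ → PvD⇓ (G₀ ⊃ A) 𝒫 A
    pv-∀    : ∀ {𝒫 D A} (t : Term) → PvD⇓ (D [ t ]C) 𝒫 A → PvD⇓ (all∀ D) 𝒫 A

  data PvG : Prog → Goal → Set where
    pv-atm : ∀ {𝒫 A D} → D ∈ 𝒫 → PvD⇓ D 𝒫 A → PvG 𝒫 (atm A)
    pv-⊗   : ∀ {𝒫 G₀ G₁} → PvG 𝒫 G₀ → PvG 𝒫 G₁ → PvG 𝒫 (G₀ ⊗ G₁)
    pv-∃   : ∀ {𝒫 G₀} (t : Term) → PvG 𝒫 (G₀ [ t ]G) → PvG 𝒫 (ex∃ G₀)

pv : List DForm → Goal → Set
pv Δ G = PvD⇑ [] Δ G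

-- The user's interactive answers read(i) are
-- modelled by an arbitrary input stream  read : ℕ → Bool  (false = choose
-- i = 0, true = choose i = 1); the ℕ index of ExD⇑ counts the answers
-- consumed so far.  A successful (terminating) execution is a finite
-- derivation in these inductive relations.

module Execution (read : ℕ → Bool) where

  mutual
    data ExD⇑ : ℕ → Prog → List DForm → Goal → Set where
      ex-! : ∀ {n 𝒫 C Δ G} → ExD⇑ n (C ∷ 𝒫) Δ G → ExD⇑ n 𝒫 ((! C) ∷ Δ) G
      ex-⊕₀ : ∀ {n 𝒫 D₀ D₁ Δ G} → read n ≡ false →
              ExD⇑ (suc n) 𝒫 (D₀ ∷ Δ) G → PvD⇑ 𝒫 (D₁ ∷ Δ) G →
              ExD⇑ n 𝒫 ((D₀ ⊕ D₁) ∷ Δ) G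
      ex-⊕₁ : ∀ {n 𝒫 D₀ D₁ Δ G} → read n ≡ true →
              ExD⇑ (suc n) 𝒫 (D₁ ∷ Δ) G → PvD⇑ 𝒫 (D₀ ∷ Δ) G →
              ExD⇑ n 𝒫 ((D₀ ⊕ D₁) ∷ Δ) G
      ex-nil : ∀ {n 𝒫 G} → ExG 𝒫 G → ExD⇑ n 𝒫 [] G

    data ExD⇓ : Clause → Prog → Atom → Set where
      ex-fact : ∀ {𝒫 A} → ExD⇓ (fact A) 𝒫 A
      ex-⊃    : ∀ {𝒫 G₀ A} → ExG 𝒫 G₀ → ExD⇓ (G₀ ⊃ A) 𝒫 A
      ex-∀    : ∀ {𝒫 D A} (t : Term) → ExD⇓ (D [ t ]C) 𝒫 A → ExD⇓ (all∀ D) 𝒫 A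

    data ExG : Prog → Goal → Set where
      ex-atm : ∀ {𝒫 A D} → D ∈ 𝒫 → ExD⇓ D 𝒫 A → ExG 𝒫 (atm A)
      ex-⊗   : ∀ {𝒫 G₀ G₁} → ExG 𝒫 G₀ → ExG 𝒫 G₁ → ExG 𝒫 (G₀ ⊗ G₁)
      ex-∃   : ∀ {𝒫 G₀} (t : Term) → ExG 𝒫 (G₀ [ t ]G) → ExG 𝒫 (ex∃ G₀)

  exec : List DForm → Goal → Set
  exec Δ G = ExD⇑ 0 [] Δ G

ex : (read : ℕ → Bool) → List DForm → Goal → Set
ex read = Execution.exec read

data Formula : Set where
  at   : Atom → Formula
  _⊗'_ : Formula → Formula → Formula
  _⊕'_ : Formula → Formula → Formula
  _⊸_  : Formula → Formula → Formula
  !'_  : Formula → Formula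
  ∀'   : Formula → Formula
  ∃'   : Formula → Formula

shiftF : ℕ → Formula → Formula
shiftF c (at a)   = at (shiftA c a)
shiftF c (A ⊗' B) = shiftF c A ⊗' shiftF c B
shiftF c (A ⊕' B) = shiftF c A ⊕' shiftF c B
shiftF c (A ⊸ B)  = shiftF c A ⊸ shiftF c B
shiftF c (!' A)   = !' shiftF c A
shiftF c (∀' A)   = ∀' (shiftF (suc c) A)
shiftF c (∃' A)   = ∃' (shiftF (suc c) A)

substF : ℕ → Term → Formula → Formula
substF k t (at a)   = at (substA k t a)
substF k t (A ⊗' B) = substF k t A ⊗' substF k t B
substF k t (A ⊕' B) = substF k t A ⊕' substF k t B
substF k t (A ⊸ B)  = substF k t A ⊸ substF k t B
substF k t (!' A)   = !' substF k t A
substF k t (∀' A)   = ∀' (substF (suc k) (shiftT 0 t) A)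
substF k t (∃' A)   = ∃' (substF (suc k) (shiftT 0 t) A)

_[_]F : Formula → Term → Formula
A [ t ]F = substF 0 t A

-- shift all formulas of a context (entering the scope of a fresh eigenvariable)
↑ : List Formula → List Formula
↑ = map (shiftF 0)

infix 4 _⊢_

data _⊢_ : List Formula → Formula → Set where
  ax    : ∀ {A} → (A ∷ []) ⊢ A
  exch  : ∀ {Γ Γ' C} → Γ ↭ Γ' → Γ ⊢ C → Γ' ⊢ C
  ⊗R    : ∀ {Γ Δ A B} → Γ ⊢ A → Δ ⊢ B → (Γ ++ Δ) ⊢ A ⊗' B
  ⊗L    : ∀ {Γ A B C} → (A ∷ B ∷ Γ) ⊢ C → ((A ⊗' B) ∷ Γ) ⊢ C
  ⊕R₁   : ∀ {Γ A B} → Γ ⊢ A → Γ ⊢ A ⊕' B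
  ⊕R₂   : ∀ {Γ A B} → Γ ⊢ B → Γ ⊢ A ⊕' B
  ⊕L    : ∀ {Γ A B C} → (A ∷ Γ) ⊢ C → (B ∷ Γ) ⊢ C → ((A ⊕' B) ∷ Γ) ⊢ C
  ⊸R    : ∀ {Γ A B} → (A ∷ Γ) ⊢ B → Γ ⊢ A ⊸ B
  ⊸L    : ∀ {Γ Δ A B C} → Γ ⊢ A → (B ∷ Δ) ⊢ C → ((A ⊸ B) ∷ (Γ ++ Δ)) ⊢ C
  !W    : ∀ {Γ A C} → Γ ⊢ C → ((!' A) ∷ Γ) ⊢ C
  !C    : ∀ {Γ A C} → ((!' A) ∷ (!' A) ∷ Γ) ⊢ C → ((!' A) ∷ Γ) ⊢ C
  !D    : ∀ {Γ A C} → (A ∷ Γ) ⊢ C → ((!' A) ∷ Γ) ⊢ C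
  !R    : ∀ {Γ A} → map !'_ Γ ⊢ A → map !'_ Γ ⊢ !' A
  ∀L    : ∀ {Γ A C} (t : Term) → ((A [ t ]F) ∷ Γ) ⊢ C → ((∀' A) ∷ Γ) ⊢ C
  ∀R    : ∀ {Γ A} → ↑ Γ ⊢ A → Γ ⊢ ∀' A
  ∃L    : ∀ {Γ A C} → (A ∷ ↑ Γ) ⊢ shiftF 0 C → ((∃' A) ∷ Γ) ⊢ C
  ∃R    : ∀ {Γ A} (t : Term) → Γ ⊢ A [ t ]F → Γ ⊢ ∃' A

⌜_⌝G : Goal → Formula
⌜ atm a ⌝G  = at a
⌜ g ⊗ h ⌝G  = ⌜ g ⌝G ⊗' ⌜ h ⌝G
⌜ ex∃ g ⌝G  = ∃' ⌜ g ⌝G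

⌜_⌝C : Clause → Formula
⌜ fact a ⌝C = at a
⌜ g ⊃ a ⌝C  = ⌜ g ⌝G ⊸ at a
⌜ all∀ c ⌝C = ∀' ⌜ c ⌝C

⌜_⌝D : DForm → Formula
⌜ ! c ⌝D    = !' ⌜ c ⌝C
⌜ d ⊕ e ⌝D  = ⌜ d ⌝D ⊕' ⌜ e ⌝D

!ctx : List DForm → List Formula
!ctx Δ = map (λ d → !' ⌜ d ⌝D) Δ

-- ex and pv differ only at a choice D₀ ⊕ D₁, where ex follows the branch picked by the
-- user and checks the other one with pv; so, whatever the answers, the successful
-- executions are exactly the pv-derivations.
--
-- A pv-derivation reads as a cut-free proof of !Δ ⊢ G: a choice becomes ⊕L, a stored
-- clause !C is used by absorption (contraction and dereliction), and backchaining
-- through it becomes ∀L and ⊸L.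
--
-- Conversely, every sequent of a cut-free proof of !Δ ⊢ G has clauses and D-formulas,
-- possibly banged, on the left and a goal on the right.  Ignoring linearity, such a
-- proof can therefore be evaluated in any program 𝒬 that satisfies the stored clauses
-- and one chosen disjunct of each D-formula, and it shows that 𝒬 proves G.  Splitting
-- every ⊕ of Δ as pv does and taking for 𝒬 the program collected along each branch
-- gives pv(Δ, G).

module Submission where

open import Defs
open import Data.Nat using (ℕ; suc)
open import Data.Bool using (Bool; true; false)
open import Data.Product using (_,_)
open import Data.List using (List; []; _∷_; _++_; map)
open import Data.List.Relation.Unary.All as All using (All; []; _∷_)
open import Data.List.Relation.Unary.All.Properties using (++⁻ˡ; ++⁻ʳ; map⁺)
open import Data.List.Relation.Unary.Any using (here; there)
open import Data.List.Membership.Propositional using (_∈_)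
open import Data.List.Membership.Propositional.Properties using (∈-∃++; ∈-map⁺; ∈-++⁺ʳ)
open import Data.List.Relation.Binary.Permutation.Propositional using (prep; ↭-sym)
open import Data.List.Relation.Binary.Permutation.Propositional.Properties
  using (All-resp-↭; shift; ∷↭∷ʳ; ++-identityʳ)
open import Function.Base using (_∘_)
open import Function.Bundles using (_⇔_; mk⇔)
open import Function.Properties.Equivalence using () renaming (trans to ⇔-trans)
open import Relation.Binary.PropositionalEquality using (_≡_; refl; sym; cong; cong₂; subst)

substF-⌜⌝G : ∀ k t g → substF k t ⌜ g ⌝G ≡ ⌜ substG k t g ⌝G
substF-⌜⌝G k t (atm a) = refl
substF-⌜⌝G k t (g ⊗ h) = cong₂ _⊗'_ (substF-⌜⌝G k t g) (substF-⌜⌝G k t h)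
substF-⌜⌝G k t (ex∃ g) = cong ∃' (substF-⌜⌝G (suc k) (shiftT 0 t) g)

substF-⌜⌝C : ∀ k t c → substF k t ⌜ c ⌝C ≡ ⌜ substC k t c ⌝C
substF-⌜⌝C k t (fact a) = refl
substF-⌜⌝C k t (g ⊃ a) = cong (_⊸ at (substA k t a)) (substF-⌜⌝G k t g)
substF-⌜⌝C k t (all∀ c) = cong ∀' (substF-⌜⌝C (suc k) (shiftT 0 t) c)

module _ (read : ℕ → Bool) where
  open Execution read

  mutual
    exD⇑⇒pvD⇑ : ∀ {n 𝒫 Δ G} → ExD⇑ n 𝒫 Δ G → PvD⇑ 𝒫 Δ G
    exD⇑⇒pvD⇑ (ex-! e) = pv-! (exD⇑⇒pvD⇑ e)
    exD⇑⇒pvD⇑ (ex-⊕₀ _ e p) = pv-⊕ (exD⇑⇒pvD⇑ e) p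
    exD⇑⇒pvD⇑ (ex-⊕₁ _ e p) = pv-⊕ p (exD⇑⇒pvD⇑ e)
    exD⇑⇒pvD⇑ (ex-nil e) = pv-nil (exG⇒pvG e)

    exD⇓⇒pvD⇓ : ∀ {C 𝒫 A} → ExD⇓ C 𝒫 A → PvD⇓ C 𝒫 A
    exD⇓⇒pvD⇓ ex-fact = pv-fact
    exD⇓⇒pvD⇓ (ex-⊃ e) = pv-⊃ (exG⇒pvG e)
    exD⇓⇒pvD⇓ (ex-∀ t e) = pv-∀ t (exD⇓⇒pvD⇓ e)

    exG⇒pvG : ∀ {𝒫 G} → ExG 𝒫 G → PvG 𝒫 G
    exG⇒pvG (ex-atm C∈𝒫 e) = pv-atm C∈𝒫 (exD⇓⇒pvD⇓ e)
    exG⇒pvG (ex-⊗ e f) = pv-⊗ (exG⇒pvG e) (exG⇒pvG f)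
    exG⇒pvG (ex-∃ t e) = pv-∃ t (exG⇒pvG e)

  mutual
    pvD⇑⇒exD⇑ : ∀ {n 𝒫 Δ G} → PvD⇑ 𝒫 Δ G → ExD⇑ n 𝒫 Δ G
    pvD⇑⇒exD⇑ (pv-! p) = ex-! (pvD⇑⇒exD⇑ p)
    pvD⇑⇒exD⇑ {n} (pv-⊕ p q) with read n in answer
    ... | false = ex-⊕₀ answer (pvD⇑⇒exD⇑ p) q
    ... | true  = ex-⊕₁ answer (pvD⇑⇒exD⇑ q) p
    pvD⇑⇒exD⇑ (pv-nil p) = ex-nil (pvG⇒exG p)

    pvD⇓⇒exD⇓ : ∀ {C 𝒫 A} → PvD⇓ C 𝒫 A → ExD⇓ C 𝒫 A
    pvD⇓⇒exD⇓ pv-fact = ex-fact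
    pvD⇓⇒exD⇓ (pv-⊃ p) = ex-⊃ (pvG⇒exG p)
    pvD⇓⇒exD⇓ (pv-∀ t p) = ex-∀ t (pvD⇓⇒exD⇓ p)

    pvG⇒exG : ∀ {𝒫 G} → PvG 𝒫 G → ExG 𝒫 G
    pvG⇒exG (pv-atm C∈𝒫 p) = ex-atm C∈𝒫 (pvD⇓⇒exD⇓ p)
    pvG⇒exG (pv-⊗ p q) = ex-⊗ (pvG⇒exG p) (pvG⇒exG q)
    pvG⇒exG (pv-∃ t p) = ex-∃ t (pvG⇒exG p)

  ex⇔pv : ∀ {Δ G} → ex read Δ G ⇔ pv Δ G
  ex⇔pv = mk⇔ exD⇑⇒pvD⇑ pvD⇑⇒exD⇑

!W* : ∀ Ξ {Γ C} → Γ ⊢ C → map !'_ Ξ ++ Γ ⊢ C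
!W* []      d = d
!W* (_ ∷ Ξ) d = !W (!W* Ξ d)

absorb : ∀ {A Γ C} → !' A ∈ Γ → !' A ∷ Γ ⊢ C → Γ ⊢ C
absorb {A} !A∈Γ d with ys , zs , refl ← ∈-∃++ !A∈Γ =
  exch (↭-sym (shift (!' A) ys zs)) (!C (exch (prep (!' A) (shift (!' A) ys zs)) d))

absorb* : ∀ Ξ {Γ C} → (∀ {A} → A ∈ Ξ → !' A ∈ Γ) → map !'_ Ξ ++ Γ ⊢ C → Γ ⊢ C
absorb* []      _     d = d
absorb* (A ∷ Ξ) Ξ⊆Γ d =
  absorb* Ξ (Ξ⊆Γ ∘ there) (absorb (∈-++⁺ʳ (map !'_ Ξ) (Ξ⊆Γ (here refl))) d)

⊗R! : ∀ Ξ {A B} → map !'_ Ξ ⊢ A → map !'_ Ξ ⊢ B → map !'_ Ξ ⊢ A ⊗' B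
⊗R! Ξ d e = absorb* Ξ (∈-map⁺ !'_) (⊗R d e)

⌜_⌝P : Prog → List Formula
⌜ 𝒫 ⌝P = map ⌜_⌝C 𝒫

mutual
  pvG⇒⊢ : ∀ {𝒫 g} → PvG 𝒫 g → map !'_ ⌜ 𝒫 ⌝P ⊢ ⌜ g ⌝G
  pvG⇒⊢ (pv-atm C∈𝒫 p) = absorb (∈-map⁺ !'_ (∈-map⁺ ⌜_⌝C C∈𝒫)) (!D (pvD⇓⇒⊢ p))
  pvG⇒⊢ {𝒫} (pv-⊗ p q) = ⊗R! ⌜ 𝒫 ⌝P (pvG⇒⊢ p) (pvG⇒⊢ q)
  pvG⇒⊢ (pv-∃ {G₀ = g} t p) = ∃R t (subst (_ ⊢_) (sym (substF-⌜⌝G 0 t g)) (pvG⇒⊢ p))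

  pvD⇓⇒⊢ : ∀ {C 𝒫 A} → PvD⇓ C 𝒫 A → ⌜ C ⌝C ∷ map !'_ ⌜ 𝒫 ⌝P ⊢ at A
  pvD⇓⇒⊢ {𝒫 = 𝒫} {A} pv-fact = exch (↭-sym (∷↭∷ʳ (at A) _)) (!W* ⌜ 𝒫 ⌝P ax)
  pvD⇓⇒⊢ (pv-⊃ p) = exch (prep _ (++-identityʳ _)) (⊸L (pvG⇒⊢ p) ax)
  pvD⇓⇒⊢ (pv-∀ {D = C} t p) =
    ∀L t (subst (λ F → F ∷ _ ⊢ _) (sym (substF-⌜⌝C 0 t C)) (pvD⇓⇒⊢ p))

mutual
  pvD⇑⇒⊢ : ∀ {𝒫 Δ G} → PvD⇑ 𝒫 Δ G → !ctx Δ ++ map !'_ ⌜ 𝒫 ⌝P ⊢ ⌜ G ⌝G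
  pvD⇑⇒⊢ (pv-nil p) = pvG⇒⊢ p
  pvD⇑⇒⊢ {Δ = _ ∷ _} p = !D (pvD⇑⇒⊢-head p)

  pvD⇑⇒⊢-head : ∀ {𝒫 D Δ G} → PvD⇑ 𝒫 (D ∷ Δ) G →
                ⌜ D ⌝D ∷ !ctx Δ ++ map !'_ ⌜ 𝒫 ⌝P ⊢ ⌜ G ⌝G
  pvD⇑⇒⊢-head {𝒫} {Δ = Δ} (pv-! {C = C} p) =
    exch (shift (!' ⌜ C ⌝C) (!ctx Δ) (map !'_ ⌜ 𝒫 ⌝P)) (pvD⇑⇒⊢ p)
  pvD⇑⇒⊢-head (pv-⊕ p q) = ⊕L (pvD⇑⇒⊢-head p) (pvD⇑⇒⊢-head q)

_⊨_ : Prog → Clause → Set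
𝒬 ⊨ C = ∀ {A} → PvD⇓ C 𝒬 A → PvG 𝒬 (atm A)

∈⇒⊨ : ∀ {𝒬 C} → C ∈ 𝒬 → 𝒬 ⊨ C
∈⇒⊨ C∈𝒬 = pv-atm C∈𝒬

-- A quantified clause is kept in source form (gen), so that ∀L instantiates it with
-- substC and the evaluation of a proof recurses on the derivation only.
data Valid (𝒬 : Prog) : Formula → Set where
  atom  : ∀ {a} → PvG 𝒬 (atm a) → Valid 𝒬 (at a)
  rule  : ∀ {g a} → (PvG 𝒬 g → PvG 𝒬 (atm a)) → Valid 𝒬 (⌜ g ⌝G ⊸ at a)
  gen   : ∀ {C} → 𝒬 ⊨ all∀ C → Valid 𝒬 (∀' ⌜ C ⌝C)
  bang  : ∀ {A} → Valid 𝒬 A → Valid 𝒬 (!' A)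
  left  : ∀ {A B} → Valid 𝒬 A → Valid 𝒬 (A ⊕' B)
  right : ∀ {A B} → Valid 𝒬 B → Valid 𝒬 (A ⊕' B)

⊨⇒Valid : ∀ {𝒬} C → 𝒬 ⊨ C → Valid 𝒬 ⌜ C ⌝C
⊨⇒Valid (fact a) v = atom (v pv-fact)
⊨⇒Valid (g ⊃ a) v = rule (λ p → v (pv-⊃ p))
⊨⇒Valid (all∀ C) v = gen v

Valid-instance : ∀ {𝒬 C} t → 𝒬 ⊨ all∀ C → Valid 𝒬 (⌜ C ⌝C [ t ]F)
Valid-instance {C = C} t v =
  subst (Valid _) (sym (substF-⌜⌝C 0 t C)) (⊨⇒Valid (C [ t ]C) (v ∘ pv-∀ t))

Valid⇒pvG : ∀ {𝒬} g → Valid 𝒬 ⌜ g ⌝G → PvG 𝒬 g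
Valid⇒pvG (atm a) (atom p) = p

⊢⇒pvG : ∀ {𝒬 Γ F g} → Γ ⊢ F → All (Valid 𝒬) Γ → F ≡ ⌜ g ⌝G → PvG 𝒬 g
⊢⇒pvG {g = g} ax (v ∷ _) refl = Valid⇒pvG g v
⊢⇒pvG (exch π d) vs eq = ⊢⇒pvG d (All-resp-↭ (↭-sym π) vs) eq
⊢⇒pvG {g = g ⊗ h} (⊗R {Γ} d e) vs refl =
  pv-⊗ (⊢⇒pvG d (++⁻ˡ Γ vs) refl) (⊢⇒pvG e (++⁻ʳ Γ vs) refl)
⊢⇒pvG {g = ex∃ g} (∃R t d) vs refl = pv-∃ t (⊢⇒pvG d vs (substF-⌜⌝G 0 t g))
⊢⇒pvG (⊗L d) (() ∷ _) eq
⊢⇒pvG (∃L d) (() ∷ _) eq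
⊢⇒pvG (⊕L d e) (left v ∷ vs) eq = ⊢⇒pvG d (v ∷ vs) eq
⊢⇒pvG (⊕L d e) (right v ∷ vs) eq = ⊢⇒pvG e (v ∷ vs) eq
⊢⇒pvG (⊸L {Γ} d e) (rule {g} f ∷ vs) eq =
  ⊢⇒pvG e (atom (f (⊢⇒pvG {g = g} d (++⁻ˡ Γ vs) refl)) ∷ ++⁻ʳ Γ vs) eq
⊢⇒pvG (∀L t d) (gen v ∷ vs) eq = ⊢⇒pvG d (Valid-instance t v ∷ vs) eq
⊢⇒pvG (!W d) (_ ∷ vs) eq = ⊢⇒pvG d vs eq
⊢⇒pvG (!C d) (v ∷ vs) eq = ⊢⇒pvG d (v ∷ v ∷ vs) eq
⊢⇒pvG (!D d) (bang v ∷ vs) eq = ⊢⇒pvG d (v ∷ vs) eq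
⊢⇒pvG {g = atm _} (⊕R₁ _) _ ()
⊢⇒pvG {g = _ ⊗ _} (⊕R₁ _) _ ()
⊢⇒pvG {g = ex∃ _} (⊕R₁ _) _ ()
⊢⇒pvG {g = atm _} (⊕R₂ _) _ ()
⊢⇒pvG {g = _ ⊗ _} (⊕R₂ _) _ ()
⊢⇒pvG {g = ex∃ _} (⊕R₂ _) _ ()
⊢⇒pvG {g = atm _} (⊸R _) _ ()
⊢⇒pvG {g = _ ⊗ _} (⊸R _) _ ()
⊢⇒pvG {g = ex∃ _} (⊸R _) _ ()
⊢⇒pvG {g = atm _} (!R _) _ ()
⊢⇒pvG {g = _ ⊗ _} (!R _) _ ()
⊢⇒pvG {g = ex∃ _} (!R _) _ ()
⊢⇒pvG {g = atm _} (∀R _) _ ()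
⊢⇒pvG {g = _ ⊗ _} (∀R _) _ ()
⊢⇒pvG {g = ex∃ _} (∀R _) _ ()

Entails : Prog → List DForm → Goal → Set
Entails 𝒫 Δ G = ∀ 𝒬 → All (𝒬 ⊨_) 𝒫 → All (Valid 𝒬 ∘ ⌜_⌝D) Δ → PvG 𝒬 G

mutual
  entails⇒pvD⇑ : ∀ {𝒫} Δ {G} → Entails 𝒫 Δ G → PvD⇑ 𝒫 Δ G
  entails⇒pvD⇑ {𝒫} [] e = pv-nil (e 𝒫 (All.tabulate ∈⇒⊨) [])
  entails⇒pvD⇑ (D ∷ Δ) e = entails⇒pvD⇑-head D Δ e

  entails⇒pvD⇑-head : ∀ {𝒫} D Δ {G} → Entails 𝒫 (D ∷ Δ) G → PvD⇑ 𝒫 (D ∷ Δ) G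
  entails⇒pvD⇑-head (! C) Δ e =
    pv-! (entails⇒pvD⇑ Δ λ { 𝒬 (v ∷ vs) ws → e 𝒬 vs (bang (⊨⇒Valid C v) ∷ ws) })
  entails⇒pvD⇑-head (D₀ ⊕ D₁) Δ e =
    pv-⊕ (entails⇒pvD⇑-head D₀ Δ λ { 𝒬 vs (w ∷ ws) → e 𝒬 vs (left w ∷ ws) })
         (entails⇒pvD⇑-head D₁ Δ λ { 𝒬 vs (w ∷ ws) → e 𝒬 vs (right w ∷ ws) })

⊢⇒entails : ∀ {Δ G} → !ctx Δ ⊢ ⌜ G ⌝G → Entails [] Δ G
⊢⇒entails d 𝒬 _ ws = ⊢⇒pvG d (map⁺ (All.map bang ws)) refl

pv⇔⊢ : ∀ Δ G → pv Δ G ⇔ (!ctx Δ ⊢ ⌜ G ⌝G)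
pv⇔⊢ Δ G = mk⇔
  (λ p → exch (++-identityʳ (!ctx Δ)) (pvD⇑⇒⊢ p))
  (λ d → entails⇒pvD⇑ Δ (⊢⇒entails d))

mainTheorem2 : (read : ℕ → Bool) (Δ : List DForm) (G : Goal) →
               ex read Δ G ⇔ (!ctx Δ ⊢ ⌜ G ⌝G)
mainTheorem2 read Δ G = ⇔-trans (ex⇔pv read) (pv⇔⊢ Δ G)
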